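{- Every $N\in\mathbb Z$ has a unique representation $N=\sum_{j=1}^n y_jS_{n-j}$ with $y_1\ne0$ and $y_1\cdots y_n\in\{ -1,0,1\}^*$ containing no factor from the set $X=\{10^61\}\cup\{10^k1,\,10^k\bar1:0\le k\le5\}$ together with their opposites, with the exception that $10^61$, $10^51$, $10^5\bar1$, $10^4\bar1$ and their opposites may occur as suffixes of $y_1\cdots y_n$.
   Context: The sequence $(S_n)_{n\ge0}$: $S_0=1$, $S_1=2$, $S_2=3$, $S_3=4$, $S_n=S_{n-2}+S_{n-3}$ for $n\ge4$. $\bar1$ denotes the digit $-1$; $0^k$ denotes $k$ zeros; the opposite of a word is obtained by negating every digit. A factor is a contiguous subword. -}

module Defs where

open import Data.Nat using (ℕ; zero; suc)
open import Data.Integer using (ℤ; +_; -_; _+_; _*_; 0ℤ; 1ℤ)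
open import Data.List using (List; []; _∷_; length; _++_; map; replicate)
open import Data.List.Membership.Propositional using (_∈_)
open import Data.Product using (_×_)
open import Relation.Binary.PropositionalEquality using (_≡_; _≢_)

S : ℕ → ℕ
S 0 = 1
S 1 = 2
S 2 = 3
S 3 = 4
S (suc (suc (suc (suc n)))) = S (suc (suc n)) Data.Nat.+ S (suc n)

data Digit : Set where
  m o p : Digit

digitℤ : Digit → ℤ
digitℤ m = - 1ℤ
digitℤ o = 0ℤ
digitℤ p = 1ℤ

opp : Digit → Digit
opp m = p
opp o = o
opp p = m

Word : Set
Word = List Digit

opposite : Word → Word
opposite = map opp

value : Word → ℤ
value [] = 0ℤ
value (d ∷ ds) = digitℤ d * (+ S (length ds)) + value ds

one0^ : ℕ → Digit → Word
one0^ k d = p ∷ (replicate k o ++ (d ∷ []))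

X : List Word
X = one0^ 6 p
  ∷ one0^ 0 p ∷ one0^ 1 p ∷ one0^ 2 p ∷ one0^ 3 p ∷ one0^ 4 p ∷ one0^ 5 p
  ∷ one0^ 0 m ∷ one0^ 1 m ∷ one0^ 2 m ∷ one0^ 3 m ∷ one0^ 4 m ∷ one0^ 5 m
  ∷ []

SuffixOK : List Word
SuffixOK = one0^ 6 p ∷ one0^ 5 p ∷ one0^ 5 m ∷ one0^ 4 m ∷ []

Forbidden : Word → Set
Forbidden f = (f ∈ X) Data.Sum.⊎ (opposite f ∈ X)
  where import Data.Sum

Exempt : Word → Set
Exempt f = (f ∈ SuffixOK) Data.Sum.⊎ (opposite f ∈ SuffixOK)
  where import Data.Sum

Admissible : Word → Set
Admissible y = ∀ (u f w : Word) → y ≡ u ++ f ++ w → Forbidden f → Exempt f × w ≡ []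

-- y1 ≠ 0 (vacuous for the empty word, which represents N = 0)
LeadingNonzero : Word → Set
LeadingNonzero [] = Data.Unit.⊤
  where import Data.Unit
LeadingNonzero (d ∷ _) = d ≢ o

Representation : ℤ → Word → Set
Representation N y = LeadingNonzero y × Admissible y × value y ≡ N

-- Let maxVal r be the largest value of an admissible word of length r. Reading off X, consecutive
-- nonzero digits of an admissible word are separated by at least 7 zeros if they have the same sign and
-- by at least 6 if their signs differ, except that 5 or 6, resp. 4 or 5, zeros are allowed before the
-- last letter. Hence a word d y with d ≠ 0 and |y| = r has value ±v with
-- S r − switchTail r ≤ v ≤ S r + sameTail r = maxVal (r + 1), and the identity
-- S r = maxVal r + 1 + switchTail r makes these ranges tile the positive integers. So N determines the
-- length and the leading digit of its representation, and N − d S r is a number of smaller absolute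
-- value whose representation has to fill the rest: one greedy recursion gives existence and uniqueness.

module Submission where

open import Defs
open import Data.Bool using (Bool; true; false; not; _∧_; _∨_)
open import Data.Empty using (⊥-elim)
import Data.Integer as ℤ
open ℤ using (ℤ; +_; -_; _⊖_; _◃_; 0ℤ)
import Data.Integer.Properties as ℤᵖ
open import Algebra.Properties.AbelianGroup ℤᵖ.+-0-abelianGroup using (∙-cancelˡ)
open import Data.List using ([]; _∷_; length; null; replicate; _++_)
open import Data.List.Properties
  using (≡-dec; ++-identityʳ; ++-assoc; ∷-injectiveˡ; ∷-injectiveʳ; length-++; length-replicate; length-map;
         map-++; map-replicate; map-∘; map-cong; map-id)
open import Data.List.Relation.Unary.All as All using (All; []; _∷_)
open import Data.Nat
open import Data.Nat.Induction using (<-rec)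
open import Data.Nat.Properties
open import Data.Nat.Tactic.RingSolver using (solve-∀)
open import Data.Product using (Σ; ∃-syntax; _×_; _,_; proj₁; proj₂)
open import Data.Sign using (Sign)
open import Data.Sum using (_⊎_; inj₁; inj₂)
open import Relation.Binary.Definitions using (DecidableEquality; tri<; tri≈; tri>)
open import Relation.Binary.PropositionalEquality
open import Relation.Nullary using (Dec; yes; no; does; contradiction; _⊎-dec_)
open import Relation.Nullary.Decidable using (from-yes)
open import Relation.Unary using (Decidable)

data Nonzero : Digit → Set where
  plus  : Nonzero p
  minus : Nonzero m

nonzero⇒≢o : ∀ {d} → Nonzero d → d ≢ o
nonzero⇒≢o plus  ()
nonzero⇒≢o minus ()

≢o⇒nonzero : ∀ {d} → d ≢ o → Nonzero d
≢o⇒nonzero {p} _   = plus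
≢o⇒nonzero {m} _   = minus
≢o⇒nonzero {o} d≢o = ⊥-elim (d≢o refl)

nonzero-opp : ∀ {d} → Nonzero d → Nonzero (opp d)
nonzero-opp plus  = minus
nonzero-opp minus = plus

data SignStep (d : Digit) : Digit → Set where
  same   : SignStep d d
  switch : SignStep d (opp d)

signStep : ∀ {d e} → Nonzero d → Nonzero e → SignStep d e
signStep plus  plus  = same
signStep plus  minus = switch
signStep minus minus = same
signStep minus plus  = switch

signStep-nonzero : ∀ {d e} → Nonzero d → SignStep d e → Nonzero e
signStep-nonzero nd same   = nd
signStep-nonzero nd switch = nonzero-opp nd

-- Value ranges

-- After a leading digit of weight S r, the rest of a word contributes at most sameTail r if its first
-- nonzero digit has the same sign, and takes away at most switchTail r if the sign changes.
mutual
  maxVal : ℕ → ℕ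
  maxVal zero    = 0
  maxVal (suc r) = S r + sameTail r

  sameTail : ℕ → ℕ
  sameTail zero    = 0
  sameTail (suc r) = switchTail r

  switchTail : ℕ → ℕ
  switchTail (suc (suc (suc (suc (suc (suc (suc n))))))) = maxVal (suc n)
  switchTail 5 = 1
  switchTail 6 = 1
  switchTail _ = 0

S[9+n]≡S[8+n]+S[2+n]+S[1+n] : ∀ n → S (9 + n) ≡ S (8 + n) + S (2 + n) + S (1 + n)
S[9+n]≡S[8+n]+S[2+n]+S[1+n] n = rearrange (S (5 + n)) (S (6 + n)) (S (2 + n)) (S (1 + n))
  where
  rearrange : ∀ a b c d → (a + (c + d)) + b ≡ (b + a) + c + d
  rearrange = solve-∀

S≡1+maxVal+switchTail : ∀ r → S r ≡ suc (maxVal r) + switchTail r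
S≡1+maxVal+switchTail 0  = refl
S≡1+maxVal+switchTail 1  = refl
S≡1+maxVal+switchTail 2  = refl
S≡1+maxVal+switchTail 3  = refl
S≡1+maxVal+switchTail 4  = refl
S≡1+maxVal+switchTail 5  = refl
S≡1+maxVal+switchTail 6  = refl
S≡1+maxVal+switchTail 7  = refl
S≡1+maxVal+switchTail 8  = refl
S≡1+maxVal+switchTail 9  = refl
S≡1+maxVal+switchTail 10 = refl
S≡1+maxVal+switchTail 11 = refl
S≡1+maxVal+switchTail 12 = refl
S≡1+maxVal+switchTail 13 = refl
S≡1+maxVal+switchTail 14 = refl
S≡1+maxVal+switchTail r@(suc (suc (suc (suc (suc (suc (suc (suc q@(suc (suc (suc (suc (suc (suc (suc n))))))))))))))) = begin
  S r
    ≡⟨ S[9+n]≡S[8+n]+S[2+n]+S[1+n] (6 + n) ⟩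
  S (14 + n) + S (8 + n) + S (7 + n)
    ≡⟨ cong (λ x → S (14 + n) + S (8 + n) + x) (S≡1+maxVal+switchTail q) ⟩
  S (14 + n) + S (8 + n) + (suc (maxVal (7 + n)) + maxVal (1 + n))
    ≡⟨ rearrange (S (14 + n)) (S (8 + n)) (maxVal (7 + n)) (maxVal (1 + n)) ⟩
  suc (maxVal r) + switchTail r
    ∎
  where
  open ≡-Reasoning
  rearrange : ∀ a b c d → a + b + (suc c + d) ≡ suc (a + c) + (b + d)
  rearrange = solve-∀

maxVal<S : ∀ r → maxVal r < S r
maxVal<S r = subst (maxVal r <_) (sym (S≡1+maxVal+switchTail r)) (m≤m+n (suc (maxVal r)) (switchTail r))

switchTail≤S : ∀ r → switchTail r ≤ S r
switchTail≤S r = subst (switchTail r ≤_) (sym (S≡1+maxVal+switchTail r)) (m≤n+m (switchTail r) (suc (maxVal r)))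

S∸switchTail≡1+maxVal : ∀ r → S r ∸ switchTail r ≡ suc (maxVal r)
S∸switchTail≡1+maxVal r =
  trans (cong (_∸ switchTail r) (S≡1+maxVal+switchTail r)) (m+n∸n≡m (suc (maxVal r)) (switchTail r))

S∸1+maxVal≡switchTail : ∀ r → S r ∸ suc (maxVal r) ≡ switchTail r
S∸1+maxVal≡switchTail r =
  trans (cong (_∸ suc (maxVal r)) (S≡1+maxVal+switchTail r)) (m+n∸m≡n (suc (maxVal r)) (switchTail r))

S≤maxVal-suc : ∀ r → S r ≤ maxVal (suc r)
S≤maxVal-suc r = m≤m+n (S r) (sameTail r)

maxVal-<-suc : ∀ r → maxVal r < maxVal (suc r)
maxVal-<-suc r = <-≤-trans (maxVal<S r) (S≤maxVal-suc r)

maxVal-mono-< : ∀ {a b} → a < b → maxVal a < maxVal b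
maxVal-mono-< {a} {suc b} a<1+b with m≤n⇒m<n∨m≡n (≤-pred a<1+b)
... | inj₁ a<b  = <-trans (maxVal-mono-< a<b) (maxVal-<-suc b)
... | inj₂ refl = maxVal-<-suc b

maxVal-mono-≤ : ∀ {a b} → a ≤ b → maxVal a ≤ maxVal b
maxVal-mono-≤ a≤b with m≤n⇒m<n∨m≡n a≤b
... | inj₁ a<b  = <⇒≤ (maxVal-mono-< a<b)
... | inj₂ refl = ≤-refl

maxVal-cancel-< : ∀ {a b} → maxVal a < maxVal b → a < b
maxVal-cancel-< h = ≰⇒> (λ b≤a → <⇒≱ h (maxVal-mono-≤ b≤a))

switchTail≤maxVal : ∀ r → switchTail r ≤ maxVal r
switchTail≤maxVal (suc (suc (suc (suc (suc (suc (suc n))))))) = maxVal-mono-≤ (s≤s (m≤n+m n 6))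
switchTail≤maxVal 5 = s≤s z≤n
switchTail≤maxVal 6 = s≤s z≤n
switchTail≤maxVal 0 = z≤n
switchTail≤maxVal 1 = z≤n
switchTail≤maxVal 2 = z≤n
switchTail≤maxVal 3 = z≤n
switchTail≤maxVal 4 = z≤n

record InRange (r v : ℕ) : Set where
  constructor inRange
  field
    lower : maxVal r < v
    upper : v ≤ maxVal (suc r)

inRange-unique : ∀ {r r′ v} → InRange r v → InRange r′ v → r ≡ r′
inRange-unique {r} {r′} (inRange lo hi) (inRange lo′ hi′) with <-cmp r r′
... | tri< r<r′ _ _ = ⊥-elim (<-irrefl refl (<-≤-trans lo′ (≤-trans hi (maxVal-mono-≤ r<r′))))
... | tri≈ _ r≡r′ _ = r≡r′
... | tri> _ _ r′<r = ⊥-elim (<-irrefl refl (<-≤-trans lo (≤-trans hi′ (maxVal-mono-≤ r′<r))))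

inRange-exists : ∀ v → 0 < v → ∃[ r ] InRange r v
inRange-exists 1 _ = 0 , inRange (s≤s z≤n) (s≤s z≤n)
inRange-exists (suc (suc v)) _ with inRange-exists (suc v) z<s
... | r , inRange lo hi with suc (suc v) ≤? maxVal (suc r)
...   | yes h = r , inRange (m<n⇒m<1+n lo) h
...   | no h  = suc r , inRange (s≤s (≤-reflexive top)) (≤-trans (s≤s (≤-reflexive (sym top))) (maxVal-<-suc (suc r)))
  where
  top : maxVal (suc r) ≡ suc v
  top = ≤-antisym (≤-pred (≰⇒> h)) hi

-- Gaps between nonzero digits

-- The gaps 0^k between consecutive nonzero digits that X allows; final says that the second digit ends
-- the word, and equal signs need one zero more than opposite signs.
switchGapOK : ℕ → Bool → Bool
switchGapOK 4 final = final
switchGapOK 5 final = final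
switchGapOK (suc (suc (suc (suc (suc (suc _)))))) _ = true
switchGapOK _ _ = false

sameGapOK : ℕ → Bool → Bool
sameGapOK zero    _ = false
sameGapOK (suc k)   = switchGapOK k

gapOK : ∀ {d e} → SignStep d e → ℕ → Bool → Bool
gapOK same   = sameGapOK
gapOK switch = switchGapOK

gapTail : ∀ {d e} → SignStep d e → ℕ → ℕ
gapTail same   = sameTail
gapTail switch = switchTail

switchGap-bound : ∀ k (w : Word) → switchGapOK k (null w) ≡ true →
                  maxVal (suc (length w)) ≤ switchTail (k + suc (length w))
switchGap-bound 4 [] _ = ≤-refl
switchGap-bound 5 [] _ = ≤-refl
switchGap-bound (suc (suc (suc (suc (suc (suc j)))))) w _ rewrite +-suc j (length w) =
  maxVal-mono-≤ (s≤s (m≤n+m (length w) j))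
switchGap-bound 0 _ ()
switchGap-bound 1 _ ()
switchGap-bound 2 _ ()
switchGap-bound 3 _ ()
switchGap-bound 4 (_ ∷ _) ()
switchGap-bound 5 (_ ∷ _) ()

gap-bound : ∀ {d e} (st : SignStep d e) k (w : Word) → gapOK st k (null w) ≡ true →
            maxVal (suc (length w)) ≤ gapTail st (k + suc (length w))
gap-bound same   (suc k) w ok = switchGap-bound k w ok
gap-bound switch k       w ok = switchGap-bound k w ok

switchGap-exists : ∀ r (w : Word) → maxVal (length w) < switchTail r →
                   ∃[ k ] k + suc (length w) ≡ r × switchGapOK k (null w) ≡ true
switchGap-exists (suc (suc (suc (suc (suc (suc (suc n))))))) w h =
  6 + (n ∸ length w) ,
  cong (_+_ 6) (trans (+-suc (n ∸ length w) (length w)) (cong suc (m∸n+n≡m ∣w∣≤n))) ,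
  refl
  where
  ∣w∣≤n : length w ≤ n
  ∣w∣≤n = ≤-pred (maxVal-cancel-< {length w} {suc n} h)
switchGap-exists 5 []      _ = 4 , refl , refl
switchGap-exists 6 []      _ = 5 , refl , refl
switchGap-exists 5 (_ ∷ w) h = ⊥-elim (<⇒≱ h (maxVal-mono-≤ {1} {suc (length w)} (s≤s z≤n)))
switchGap-exists 6 (_ ∷ w) h = ⊥-elim (<⇒≱ h (maxVal-mono-≤ {1} {suc (length w)} (s≤s z≤n)))

gap-exists : ∀ {d e} (st : SignStep d e) r (w : Word) → maxVal (length w) < gapTail st r →
             ∃[ k ] k + suc (length w) ≡ r × gapOK st k (null w) ≡ true
gap-exists same (suc r) w h with switchGap-exists r w h
... | k , k+1+∣w∣≡r , ok = suc k , cong suc k+1+∣w∣≡r , ok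
gap-exists switch r w h = switchGap-exists r w h

stepValue : ∀ {d e} → SignStep d e → ℕ → ℕ → ℕ
stepValue same   r v = S r + v
stepValue switch r v = S r ∸ v

stepValue-inRange : ∀ {d e} (st : SignStep d e) {r v} → v ≤ gapTail st r → InRange r (stepValue st r v)
stepValue-inRange same {r} {v} v≤ = inRange (<-≤-trans (maxVal<S r) (m≤m+n (S r) v)) (+-monoʳ-≤ (S r) v≤)
stepValue-inRange switch {r} {v} v≤ = inRange lower (≤-trans (m∸n≤m (S r) v) (S≤maxVal-suc r))
  where
  lower : suc (maxVal r) ≤ S r ∸ v
  lower = subst (_≤ S r ∸ v) (S∸switchTail≡1+maxVal r) (∸-monoʳ-≤ (S r) v≤)

-- Normal words

signed : Digit → ℕ → ℤ
signed d v = digitℤ d ℤ.* + v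

sign : ∀ {d} → Nonzero d → Sign
sign plus  = Sign.+
sign minus = Sign.-

sign-injective : ∀ {d d′} (nd : Nonzero d) (nd′ : Nonzero d′) → sign nd ≡ sign nd′ → d ≡ d′
sign-injective plus  plus  _ = refl
sign-injective minus minus _ = refl
sign-injective plus  minus ()
sign-injective minus plus  ()

signed-p : ∀ v → signed p v ≡ + v
signed-p v = ℤᵖ.*-identityˡ (+ v)

signed-m : ∀ v → signed m v ≡ - + v
signed-m v = ℤᵖ.-1*i≡-i (+ v)

signed-◃ : ∀ {d} (nd : Nonzero d) v → signed d v ≡ sign nd ◃ v
signed-◃ plus  v = trans (signed-p v) (sym (ℤᵖ.+◃n≡+n v))
signed-◃ minus v = trans (signed-m v) (sym (ℤᵖ.-◃n≡-n v))

signed-injective : ∀ {d d′ v v′} (nd : Nonzero d) (nd′ : Nonzero d′) → 0 < v →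
                   signed d v ≡ signed d′ v′ → d ≡ d′ × v ≡ v′
signed-injective {v = suc _} {v′} nd nd′ _ eq with trans (sym (signed-◃ nd _)) (trans eq (signed-◃ nd′ v′))
... | ◃eq with ℤᵖ.abs-cong ◃eq
...   | refl = sign-injective nd nd′ (ℤᵖ.sign-cong ◃eq) , refl

signed-+ : ∀ d a b → signed d a ℤ.+ signed d b ≡ signed d (a + b)
signed-+ d a b = trans (sym (ℤᵖ.*-distribˡ-+ (digitℤ d) (+ a) (+ b))) (cong (digitℤ d ℤ.*_) (sym (ℤᵖ.pos-+ a b)))

signed-∸ : ∀ {d a b} → Nonzero d → b ≤ a → signed d a ℤ.+ signed (opp d) b ≡ signed d (a ∸ b)
signed-∸ {a = a} {b} plus b≤a = begin
  signed p a ℤ.+ signed m b  ≡⟨ cong₂ ℤ._+_ (signed-p a) (signed-m b) ⟩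
  + a ℤ.+ - + b              ≡⟨ ℤᵖ.m-n≡m⊖n a b ⟩
  a ⊖ b                      ≡⟨ ℤᵖ.⊖-≥ b≤a ⟩
  + (a ∸ b)                  ≡⟨ signed-p (a ∸ b) ⟨
  signed p (a ∸ b)           ∎
  where open ≡-Reasoning
signed-∸ {a = a} {b} minus b≤a = begin
  signed m a ℤ.+ signed p b  ≡⟨ cong₂ ℤ._+_ (signed-m a) (signed-p b) ⟩
  - + a ℤ.+ + b              ≡⟨ ℤᵖ.-m+n≡n⊖m a b ⟩
  b ⊖ a                      ≡⟨ ℤᵖ.⊖-swap b a ⟩
  - (a ⊖ b)                  ≡⟨ cong -_ (ℤᵖ.⊖-≥ b≤a) ⟩
  - + (a ∸ b)                ≡⟨ signed-m (a ∸ b) ⟨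
  signed m (a ∸ b)           ∎
  where open ≡-Reasoning

signed-step : ∀ {d e r v} → Nonzero d → (st : SignStep d e) → v ≤ gapTail st r →
              signed d (S r) ℤ.+ signed e v ≡ signed d (stepValue st r v)
signed-step {d} {r = r} {v} _  same   _  = signed-+ d (S r) v
signed-step {r = r}         nd switch v≤ = signed-∸ nd (≤-trans v≤ (switchTail≤S r))

value-zeros-++ : ∀ k (w : Word) → value (replicate k o ++ w) ≡ value w
value-zeros-++ zero    w = refl
value-zeros-++ (suc k) w = trans (ℤᵖ.+-identityˡ _) (value-zeros-++ k w)

value-zeros : ∀ k → value (replicate k o) ≡ 0ℤ
value-zeros k = trans (cong value (sym (++-identityʳ (replicate k o)))) (value-zeros-++ k [])

length-zeros-++ : ∀ k (w : Word) → length (replicate k o ++ w) ≡ k + length w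
length-zeros-++ k w = trans (length-++ (replicate k o)) (cong (_+ length w) (length-replicate k))

value-gap : ∀ d k e (w : Word) →
            value (d ∷ replicate k o ++ e ∷ w) ≡ signed d (S (k + suc (length w))) ℤ.+ value (e ∷ w)
value-gap d k e w =
  cong₂ (λ r x → signed d (S r) ℤ.+ x) (length-zeros-++ k (e ∷ w)) (value-zeros-++ k (e ∷ w))

-- null w says whether e is the last letter, the only position where the suffix exemptions apply.
data Normal : Word → Set where
  single : ∀ {d} → Nonzero d → ∀ k → Normal (d ∷ replicate k o)
  cons   : ∀ {d e w} → Nonzero d → (st : SignStep d e) → ∀ k → Normal (e ∷ w) →
           gapOK st k (null w) ≡ true → Normal (d ∷ replicate k o ++ e ∷ w)

normal-lead : ∀ {d ys} → Normal (d ∷ ys) → Nonzero d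
normal-lead (single nd _)     = nd
normal-lead (cons nd _ _ _ _) = nd

normal-value : ∀ {d ys} → Normal (d ∷ ys) → ∃[ v ] value (d ∷ ys) ≡ signed d v × InRange (length ys) v
normal-value (single {d} _ k) =
  S r , trans (cong (ℤ._+_ (signed d (S r))) (value-zeros k)) (ℤᵖ.+-identityʳ _) , inRange (maxVal<S r) (S≤maxVal-suc r)
  where r = length (replicate k o)
normal-value (cons {d} {e} {w} nd st k n ok) with normal-value n
... | v , value≡ , inRange _ v≤ =
  stepValue st r v ,
  trans (value-gap d k e w) (trans (cong (ℤ._+_ (signed d (S r))) value≡) (signed-step nd st tail≤)) ,
  subst (λ r → InRange r (stepValue st _ v)) (sym (length-zeros-++ k (e ∷ w))) (stepValue-inRange st tail≤)
  where
  r = k + suc (length w)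
  tail≤ : v ≤ gapTail st r
  tail≤ = ≤-trans v≤ (gap-bound st k w ok)

inRange-pos : ∀ {r v} → InRange r v → 0 < v
inRange-pos (inRange lo _) = ≤-<-trans z≤n lo

normal-inRange : ∀ {d ys v} → Normal (d ∷ ys) → value (d ∷ ys) ≡ signed d v → InRange (length ys) v
normal-inRange n value≡ with normal-value n
... | _ , value≡′ , range
  with signed-injective (normal-lead n) (normal-lead n) (inRange-pos range) (trans (sym value≡′) value≡)
...   | _ , refl = range

normal-value-≢0 : ∀ {y} → Normal y → value y ≢ 0ℤ
normal-value-≢0 {_ ∷ _} n value≡0 with normal-value n
... | _ , value≡ , range =
  <⇒≢ (inRange-pos range)
      (sym (proj₂ (signed-injective (normal-lead n) plus (inRange-pos range) (trans (sym value≡) value≡0))))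

normal-head : ∀ {d d′ ys ys′} → Normal (d ∷ ys) → Normal (d′ ∷ ys′) → value (d ∷ ys) ≡ value (d′ ∷ ys′) →
              d ≡ d′ × length ys ≡ length ys′ × value ys ≡ value ys′
normal-head {d} {ys = ys} {ys′} n n′ eq with normal-value n | normal-value n′
... | _ , value≡ , range | _ , value≡′ , range′
  with signed-injective (normal-lead n) (normal-lead n′) (inRange-pos range) (trans (sym value≡) (trans eq value≡′))
...   | refl , refl = refl , length≡ , ∙-cancelˡ (signed d (S (length ys))) (value ys) (value ys′) eq′
  where
  length≡ = inRange-unique range range′
  eq′ = trans eq (cong (λ r → signed d (S r) ℤ.+ value ys′) (sym length≡))

normal-injective : ∀ {y y′} → Normal y → Normal y′ → value y ≡ value y′ → y ≡ y′
normal-injective n@(single _ k) n′@(single _ k′) eq with normal-head n n′ eq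
... | refl , length≡ , _ =
  cong (λ j → _ ∷ replicate j o) (trans (sym (length-replicate k)) (trans length≡ (length-replicate k′)))
normal-injective n@(single _ k) n′@(cons _ _ k′ rest′ _) eq with normal-head n n′ eq
... | refl , _ , tail≡ =
  ⊥-elim (normal-value-≢0 rest′ (trans (sym (value-zeros-++ k′ _)) (trans (sym tail≡) (value-zeros k))))
normal-injective n@(cons _ _ k rest _) n′@(single _ k′) eq with normal-head n n′ eq
... | refl , _ , tail≡ =
  ⊥-elim (normal-value-≢0 rest (trans (sym (value-zeros-++ k _)) (trans tail≡ (value-zeros k′))))
normal-injective n@(cons _ _ k rest _) n′@(cons _ _ k′ rest′ _) eq with normal-head n n′ eq
... | refl , length≡ , tail≡
  with normal-injective rest rest′ (trans (sym (value-zeros-++ k _)) (trans tail≡ (value-zeros-++ k′ _)))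
...   | refl with +-cancelʳ-≡ _ k k′ (trans (sym (length-zeros-++ k _)) (trans length≡ (length-zeros-++ k′ _)))
...     | refl = refl

Expansion : Digit → ℕ → Set
Expansion d v = ∃[ ys ] Normal (d ∷ ys) × value (d ∷ ys) ≡ signed d v

extend : ∀ {d e r v} → Nonzero d → (st : SignStep d e) → v ≤ gapTail st r →
         Expansion e v → Expansion d (stepValue st r v)
extend {d} {e} {r} {v} nd st v≤ (ys , n , value≡)
  with gap-exists st r ys (<-≤-trans (InRange.lower (normal-inRange n value≡)) v≤)
... | k , length≡ , ok = replicate k o ++ e ∷ ys , cons nd st k n ok , (begin
  value (d ∷ replicate k o ++ e ∷ ys)                   ≡⟨ value-gap d k e ys ⟩
  signed d (S (k + suc (length ys))) ℤ.+ value (e ∷ ys) ≡⟨ cong₂ (λ r x → signed d (S r) ℤ.+ x) length≡ value≡ ⟩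
  signed d (S r) ℤ.+ signed e v                         ≡⟨ signed-step nd st v≤ ⟩
  signed d (stepValue st r v)                           ∎)
  where open ≡-Reasoning

normal-exists : ∀ v → 0 < v → ∀ {d} → Nonzero d → Expansion d v
normal-exists = <-rec (λ v → 0 < v → ∀ {d} → Nonzero d → Expansion d v) step
  where
  step : ∀ v → (∀ {v′} → v′ < v → 0 < v′ → ∀ {d} → Nonzero d → Expansion d v′) →
         0 < v → ∀ {d} → Nonzero d → Expansion d v
  step v rec 0<v {d} nd with inRange-exists v 0<v
  ... | r , inRange lo hi with <-cmp v (S r)
  ...   | tri≈ _ refl _ =
    replicate r o , single nd r ,
    trans (cong₂ (λ r x → signed d (S r) ℤ.+ x) (length-replicate r) (value-zeros r)) (ℤᵖ.+-identityʳ _)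
  ...   | tri> _ _ S<v =
    subst (Expansion d) (m+[n∸m]≡n (<⇒≤ S<v))
      (extend {r = r} nd same tail≤ (rec tail<v (m<n⇒0<n∸m S<v) nd))
    where
    tail≤ : v ∸ S r ≤ sameTail r
    tail≤ = ≤-trans (∸-monoˡ-≤ (S r) hi) (≤-reflexive (m+n∸m≡n (S r) (sameTail r)))
    tail<v : v ∸ S r < v
    tail<v = ∸-monoʳ-< (≤-<-trans z≤n (maxVal<S r)) (<⇒≤ S<v)
  ...   | tri< v<S _ _ =
    subst (Expansion d) (m∸[m∸n]≡n (<⇒≤ v<S))
      (extend {r = r} nd switch tail≤ (rec tail<v (m<n⇒0<n∸m v<S) (nonzero-opp nd)))
    where
    tail≤ : S r ∸ v ≤ switchTail r
    tail≤ = subst (S r ∸ v ≤_) (S∸1+maxVal≡switchTail r) (∸-monoʳ-≤ (S r) lo)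
    tail<v : S r ∸ v < v
    tail<v = ≤-<-trans (≤-trans tail≤ (switchTail≤maxVal r)) lo

-- Normal words are the admissible ones

_≟ᵈ_ : DecidableEquality Digit
m ≟ᵈ m = yes refl
o ≟ᵈ o = yes refl
p ≟ᵈ p = yes refl
m ≟ᵈ o = no λ ()
m ≟ᵈ p = no λ ()
o ≟ᵈ m = no λ ()
o ≟ᵈ p = no λ ()
p ≟ᵈ m = no λ ()
p ≟ᵈ o = no λ ()

open import Data.List.Membership.DecPropositional (≡-dec _≟ᵈ_) using (_∈?_)

forbidden? : Decidable Forbidden
forbidden? f = f ∈? X ⊎-dec opposite f ∈? X

exempt? : Decidable Exempt
exempt? f = f ∈? SuffixOK ⊎-dec opposite f ∈? SuffixOK

gapWord : Digit → ℕ → Digit → Word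
gapWord d k e = d ∷ replicate k o ++ e ∷ []

gapWord-length : ∀ d k e → length (gapWord d k e) ≡ 2 + k
gapWord-length d k e = cong suc (trans (length-zeros-++ k (e ∷ [])) (+-comm k 1))

admissibleGap : Word → Bool → Bool
admissibleGap f final = not (does (forbidden? f)) ∨ does (exempt? f) ∧ final

admissibleGap-intro : ∀ f {final} → (Forbidden f → Exempt f × final ≡ true) → admissibleGap f final ≡ true
admissibleGap-intro f = intro (forbidden? f) (exempt? f)
  where
  intro : ∀ {A B : Set} {final} (a? : Dec A) (b? : Dec B) → (A → B × final ≡ true) →
          not (does a?) ∨ does b? ∧ final ≡ true
  intro (no _)  _       _ = refl
  intro (yes a) (yes _) h with h a
  ... | _ , refl = refl
  intro (yes a) (no ¬b) h = contradiction (proj₁ (h a)) ¬b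

admissibleGap-elim : ∀ f {final} → Forbidden f → admissibleGap f final ≡ true → Exempt f × final ≡ true
admissibleGap-elim f = elim (forbidden? f) (exempt? f)
  where
  elim : ∀ {A B : Set} {final} (a? : Dec A) (b? : Dec B) → A →
         not (does a?) ∨ does b? ∧ final ≡ true → B × final ≡ true
  elim (no ¬a) _       a _  = contradiction a ¬a
  elim (yes _) (yes b) _ ok = b , ok
  elim (yes _) (no _)  _ ()

forbidden-length : ∀ {f} → Forbidden f → length f ≤ 8
forbidden-length (inj₁ f∈X) = All.lookup X-short f∈X
  where X-short = from-yes (All.all? (λ f → length f ≤? 8) X)
forbidden-length {f} (inj₂ f̄∈X) = ≤-trans (≤-reflexive (sym (length-map opp f))) (forbidden-length (inj₁ f̄∈X))

long-admissibleGap : ∀ d k e {final} → admissibleGap (gapWord d (7 + k) e) final ≡ true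
long-admissibleGap d k e = admissibleGap-intro (gapWord d (7 + k) e) λ φ → ⊥-elim (<⇒≱ too-long (forbidden-length φ))
  where
  too-long : 8 < length (gapWord d (7 + k) e)
  too-long = subst (8 <_) (sym (gapWord-length d (7 + k) e)) (m≤m+n 9 k)

-- Gaps of at most six zeros are compared with X by evaluation; longer gap words are longer than every
-- word of X.
sameGapOK-admissible : ∀ {d} → Nonzero d → ∀ k final → sameGapOK k final ≡ admissibleGap (gapWord d k d) final
sameGapOK-admissible plus  0 _ = refl
sameGapOK-admissible plus  1 _ = refl
sameGapOK-admissible plus  2 _ = refl
sameGapOK-admissible plus  3 _ = refl
sameGapOK-admissible plus  4 _ = refl
sameGapOK-admissible plus  5 _ = refl
sameGapOK-admissible plus  6 _ = refl
sameGapOK-admissible minus 0 _ = refl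
sameGapOK-admissible minus 1 _ = refl
sameGapOK-admissible minus 2 _ = refl
sameGapOK-admissible minus 3 _ = refl
sameGapOK-admissible minus 4 _ = refl
sameGapOK-admissible minus 5 _ = refl
sameGapOK-admissible minus 6 _ = refl
sameGapOK-admissible {d} _ (suc (suc (suc (suc (suc (suc (suc k))))))) _ = sym (long-admissibleGap d k d)

switchGapOK-admissible : ∀ {d} → Nonzero d → ∀ k final →
                         switchGapOK k final ≡ admissibleGap (gapWord d k (opp d)) final
switchGapOK-admissible plus  0 _ = refl
switchGapOK-admissible plus  1 _ = refl
switchGapOK-admissible plus  2 _ = refl
switchGapOK-admissible plus  3 _ = refl
switchGapOK-admissible plus  4 _ = refl
switchGapOK-admissible plus  5 _ = refl
switchGapOK-admissible plus  6 _ = refl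
switchGapOK-admissible minus 0 _ = refl
switchGapOK-admissible minus 1 _ = refl
switchGapOK-admissible minus 2 _ = refl
switchGapOK-admissible minus 3 _ = refl
switchGapOK-admissible minus 4 _ = refl
switchGapOK-admissible minus 5 _ = refl
switchGapOK-admissible minus 6 _ = refl
switchGapOK-admissible {d} _ (suc (suc (suc (suc (suc (suc (suc k))))))) _ = sym (long-admissibleGap d k (opp d))

gapOK-admissible : ∀ {d e} → Nonzero d → (st : SignStep d e) → ∀ k final →
                   gapOK st k final ≡ admissibleGap (gapWord d k e) final
gapOK-admissible nd same   = sameGapOK-admissible nd
gapOK-admissible nd switch = switchGapOK-admissible nd

data Gap : Word → Set where
  gap : ∀ {c c′} → Nonzero c → ∀ j → Nonzero c′ → Gap (gapWord c j c′)

opposite-involutive : ∀ w → opposite (opposite w) ≡ w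
opposite-involutive w = trans (sym (map-∘ w)) (trans (map-cong opp-involutive w) (map-id w))
  where
  opp-involutive : ∀ d → opp (opp d) ≡ d
  opp-involutive m = refl
  opp-involutive o = refl
  opp-involutive p = refl

opposite-gapWord : ∀ c j c′ → opposite (gapWord c j c′) ≡ gapWord (opp c) j (opp c′)
opposite-gapWord c j c′ =
  cong (opp c ∷_) (trans (map-++ opp (replicate j o) (c′ ∷ [])) (cong (_++ opp c′ ∷ []) (map-replicate opp j o)))

Gap-opposite : ∀ {f} → Gap f → Gap (opposite f)
Gap-opposite (gap {c} {c′} nc j nc′) =
  subst Gap (sym (opposite-gapWord c j c′)) (gap (nonzero-opp nc) j (nonzero-opp nc′))

X-gaps : All Gap X
X-gaps = gap plus 6 plus
       ∷ gap plus 0 plus  ∷ gap plus 1 plus  ∷ gap plus 2 plus  ∷ gap plus 3 plus  ∷ gap plus 4 plus  ∷ gap plus 5 plus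
       ∷ gap plus 0 minus ∷ gap plus 1 minus ∷ gap plus 2 minus ∷ gap plus 3 minus ∷ gap plus 4 minus ∷ gap plus 5 minus
       ∷ []

forbidden-gap : ∀ {f} → Forbidden f → Gap f
forbidden-gap (inj₁ f∈X)       = All.lookup X-gaps f∈X
forbidden-gap {f} (inj₂ f̄∈X) = subst Gap (opposite-involutive f) (Gap-opposite (All.lookup X-gaps f̄∈X))

zeros-++-injective : ∀ k j {e e′} {w w′ : Word} → Nonzero e → Nonzero e′ →
                     replicate k o ++ e ∷ w ≡ replicate j o ++ e′ ∷ w′ → k ≡ j × e ≡ e′ × w ≡ w′
zeros-++-injective zero    zero    _     _      refl = refl , refl , refl
zeros-++-injective zero    (suc j) plus  _      ()
zeros-++-injective zero    (suc j) minus _      ()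
zeros-++-injective (suc k) zero    _     plus   ()
zeros-++-injective (suc k) zero    _     minus  ()
zeros-++-injective (suc k) (suc j) ne    ne′    eq with zeros-++-injective k j ne ne′ (∷-injectiveʳ eq)
... | refl , e≡e′ , w≡w′ = refl , e≡e′ , w≡w′

zeros≢zeros-++ : ∀ k j {e} {w : Word} → Nonzero e → replicate k o ≢ replicate j o ++ e ∷ w
zeros≢zeros-++ zero    zero    _     ()
zeros≢zeros-++ zero    (suc j) _     ()
zeros≢zeros-++ (suc k) zero    plus  ()
zeros≢zeros-++ (suc k) zero    minus ()
zeros≢zeros-++ (suc k) (suc j) ne    eq = zeros≢zeros-++ k j ne (∷-injectiveʳ eq)

gap-++ : ∀ c j c′ (w : Word) → gapWord c j c′ ++ w ≡ c ∷ replicate j o ++ c′ ∷ w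
gap-++ c j c′ w = cong (c ∷_) (++-assoc (replicate j o) (c′ ∷ []) w)

PrefixAdmissible : Word → Set
PrefixAdmissible y = ∀ f w → y ≡ f ++ w → Forbidden f → Exempt f × w ≡ []

admissible-[] : Admissible []
admissible-[] []      f w eq φ with forbidden-gap φ | eq
... | gap _ _ _ | ()
admissible-[] (_ ∷ _) f w ()

admissible-∷ : ∀ {c y} → Admissible y → PrefixAdmissible (c ∷ y) → Admissible (c ∷ y)
admissible-∷ A P []      = P
admissible-∷ A P (_ ∷ u) f w eq = A u f w (∷-injectiveʳ eq)

admissible-suffix : ∀ u {y} → Admissible (u ++ y) → Admissible y
admissible-suffix []      A = A
admissible-suffix (c ∷ u) A = admissible-suffix u (λ u′ f w eq → A (c ∷ u′) f w (cong (c ∷_) eq))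

prefixAdmissible-o : ∀ {y} → PrefixAdmissible (o ∷ y)
prefixAdmissible-o f w eq φ with forbidden-gap φ
... | gap nc _ _ = ⊥-elim (nonzero⇒≢o nc (sym (∷-injectiveˡ eq)))

prefixAdmissible-zeros : ∀ {d} k → PrefixAdmissible (d ∷ replicate k o)
prefixAdmissible-zeros k f w eq φ with forbidden-gap φ
... | gap {c′ = c′} _ j nc′ = ⊥-elim (zeros≢zeros-++ k j nc′ (∷-injectiveʳ (trans eq (gap-++ _ j c′ w))))

prefixAdmissible-gap : ∀ {d e k w} → Nonzero d → (st : SignStep d e) → gapOK st k (null w) ≡ true →
                       PrefixAdmissible (d ∷ replicate k o ++ e ∷ w)
prefixAdmissible-gap {d} {e} {k} {w} nd st ok f w′ eq φ with forbidden-gap φ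
... | gap {c′ = c′} _ j nc′
  with ∷-injectiveˡ eq
     | zeros-++-injective k j (signStep-nonzero nd st) nc′ (∷-injectiveʳ (trans eq (gap-++ _ j c′ w′)))
...   | refl | refl , refl , refl
  with admissibleGap-elim (gapWord d k e) φ (trans (sym (gapOK-admissible nd st k (null w))) ok)
...     | ε , null≡true = ε , null≡true⇒[] w null≡true
  where
  null≡true⇒[] : ∀ (w : Word) → null w ≡ true → w ≡ []
  null≡true⇒[] [] _ = refl

admissible-zeros-++ : ∀ k {y} → Admissible y → Admissible (replicate k o ++ y)
admissible-zeros-++ zero    A = A
admissible-zeros-++ (suc k) A = admissible-∷ (admissible-zeros-++ k A) prefixAdmissible-o

normal⇒admissible : ∀ {y} → Normal y → Admissible y
normal⇒admissible (single _ k) =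
  admissible-∷ (subst Admissible (++-identityʳ _) (admissible-zeros-++ k admissible-[])) (prefixAdmissible-zeros k)
normal⇒admissible (cons nd st k n ok) =
  admissible-∷ (admissible-zeros-++ k (normal⇒admissible n)) (prefixAdmissible-gap nd st ok)

data Blocks : Word → Set where
  zeros : ∀ k → Blocks (replicate k o)
  block : ∀ k {e w} → Nonzero e → Blocks w → Blocks (replicate k o ++ e ∷ w)

blocks : ∀ z → Blocks z
blocks []      = zeros 0
blocks (o ∷ z) with blocks z
... | zeros k       = zeros (suc k)
... | block k ne bs = block (suc k) ne bs
blocks (p ∷ z) = block 0 plus (blocks z)
blocks (m ∷ z) = block 0 minus (blocks z)

admissible⇒normal : ∀ {d z} → Nonzero d → Blocks z → Admissible (d ∷ z) → Normal (d ∷ z)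
admissible⇒normal nd (zeros k) _ = single nd k
admissible⇒normal {d} nd (block k {e} {w} ne bs) A =
  cons nd st k (admissible⇒normal ne bs (admissible-suffix (d ∷ replicate k o) A))
    (trans (gapOK-admissible nd st k (null w)) (admissibleGap-intro (gapWord d k e) exempt-final))
  where
  st = signStep nd ne
  exempt-final : Forbidden (gapWord d k e) → Exempt (gapWord d k e) × null w ≡ true
  exempt-final φ with A [] (gapWord d k e) w (sym (gap-++ d k e w)) φ
  ... | ε , refl = ε , refl

Canonical : Word → Set
Canonical y = y ≡ [] ⊎ Normal y

canonical-exists : ∀ N → ∃[ y ] Canonical y × value y ≡ N
canonical-exists (+ zero) = [] , inj₁ refl , refl
canonical-exists (+ suc n) with normal-exists (suc n) z<s plus
... | ys , normal , value≡ = p ∷ ys , inj₂ normal , trans value≡ (signed-p (suc n))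
canonical-exists ℤ.-[1+ n ] with normal-exists (suc n) z<s minus
... | ys , normal , value≡ = m ∷ ys , inj₂ normal , trans value≡ (signed-m (suc n))

canonical-injective : ∀ {y y′} → Canonical y → Canonical y′ → value y ≡ value y′ → y ≡ y′
canonical-injective (inj₁ refl) (inj₁ refl) _  = refl
canonical-injective (inj₁ refl) (inj₂ n′)   eq = ⊥-elim (normal-value-≢0 n′ (sym eq))
canonical-injective (inj₂ n)    (inj₁ refl) eq = ⊥-elim (normal-value-≢0 n eq)
canonical-injective (inj₂ n)    (inj₂ n′)   eq = normal-injective n n′ eq

representation⇒canonical : ∀ {N y} → Representation N y → Canonical y
representation⇒canonical {y = []}    _           = inj₁ refl
representation⇒canonical {y = d ∷ z} (d≢o , A , _) = inj₂ (admissible⇒normal (≢o⇒nonzero d≢o) (blocks z) A)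

canonical⇒representation : ∀ {N y} → Canonical y → value y ≡ N → Representation N y
canonical⇒representation (inj₁ refl) value≡ = _ , admissible-[] , value≡
canonical⇒representation {y = _ ∷ _} (inj₂ n) value≡ = nonzero⇒≢o (normal-lead n) , normal⇒admissible n , value≡

mainTheorem16 : (N : ℤ) → Σ Word (λ y → Representation N y × ((y′ : Word) → Representation N y′ → y′ ≡ y))
mainTheorem16 N with canonical-exists N
... | y , canonical , value≡ =
  y , canonical⇒representation canonical value≡ ,
  λ y′ rep′ → canonical-injective (representation⇒canonical rep′) canonical
                (trans (proj₂ (proj₂ rep′)) (sym value≡))
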